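{- Let $p\ge2$. For any $w\in\Sigma_p^*$, the set $[\![w^*]\!]_p=\{[\![w^k]\!]_p:k\ge0\}$ is definable by a formula $\Phi_{w^*}(x)$ of existential Büchi arithmetic of base $p$.
   Context: $\Sigma_p=\{0,\dots,p-1\}$; for $w=v_m\cdots v_0\in\Sigma_p^*$, $[\![w]\!]_p=\sum_iv_ip^i$ (most significant digit first); $w^k$ is the $k$-fold concatenation. Büchi arithmetic of base $p$ is the first-order theory of $\langle\mathbb{N},0,1,+,V_p\rangle$, where $V_p(a,b)$ holds iff $a$ is the largest power of $p$ dividing $b$, and $V_p(a,0)$ never holds. A set $M\subseteq\mathbb{N}$ is defined by $\Phi(x)$ if $M=\{m:\Phi(m)\text{ holds}\}$; existential formulas consist of existential quantifiers followed by a quantifier-free formula. -}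

module Defs where

open import Data.Nat using (ℕ; zero; suc; _+_; _*_; _^_)
open import Data.Nat.Divisibility using (_∣_)
open import Data.Fin using (Fin; toℕ)
open import Data.List using (List; foldl; concat; replicate)
open import Data.Product using (Σ; ∃; _×_; _,_)
open import Data.Sum using (_⊎_)
open import Relation.Nullary using (¬_)
open import Relation.Binary.PropositionalEquality using (_≡_; _≢_)

-- Alphabet Σ_p = Fin p ; words are lists of digits, most significant first.
-- ⟦ v_m ⋯ v_0 ⟧_p = Σ v_i p^i  (Horner evaluation from the left)
⟦_⟧[_] : {p : ℕ} → List (Fin p) → ℕ → ℕ
⟦ w ⟧[ p ] = foldl (λ acc d → acc * p + toℕ d) 0 w

_^ʷ_ : {A : Set} → List A → ℕ → List A
w ^ʷ k = concat (replicate k w)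

V : ℕ → ℕ → ℕ → Set
V p a b = (∃ λ k → a ≡ p ^ k) × (a ∣ b) × ¬ (p * a ∣ b) × (b ≢ 0)

data Term (n : ℕ) : Set where
  var  : Fin n → Term n
  `0   : Term n
  `1   : Term n
  _`+_ : Term n → Term n → Term n

data QF (n : ℕ) : Set where
  _`≡_ : Term n → Term n → QF n
  `V   : Term n → Term n → QF n
  `¬   : QF n → QF n
  _`∧_ : QF n → QF n → QF n
  _`∨_ : QF n → QF n → QF n

data ExF (n : ℕ) : Set where
  qf  : QF n → ExF n
  `∃  : ExF (suc n) → ExF n

Env : ℕ → Set
Env n = Fin n → ℕ

extend : {n : ℕ} → ℕ → Env n → Env (suc n)
extend a ρ Fin.zero    = a
extend a ρ (Fin.suc i) = ρ i

evalT : {n : ℕ} → Env n → Term n → ℕ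
evalT ρ (var i)  = ρ i
evalT ρ `0       = 0
evalT ρ `1       = 1
evalT ρ (s `+ t) = evalT ρ s + evalT ρ t

semQF : {n : ℕ} → ℕ → Env n → QF n → Set
semQF p ρ (s `≡ t) = evalT ρ s ≡ evalT ρ t
semQF p ρ (`V s t) = V p (evalT ρ s) (evalT ρ t)
semQF p ρ (`¬ φ)   = ¬ semQF p ρ φ
semQF p ρ (φ `∧ ψ) = semQF p ρ φ × semQF p ρ ψ
semQF p ρ (φ `∨ ψ) = semQF p ρ φ ⊎ semQF p ρ ψ

semEx : {n : ℕ} → ℕ → Env n → ExF n → Set
semEx p ρ (qf φ) = semQF p ρ φ
semEx p ρ (`∃ φ) = Σ ℕ λ a → semEx p (extend a ρ) φ

DefinedBy : ℕ → ExF 1 → (ℕ → Set) → Set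
DefinedBy p Φ M = (m : ℕ) → (semEx p (λ _ → m) Φ → M m) × (M m → semEx p (λ _ → m) Φ)

ExistentiallyDefinable : ℕ → (ℕ → Set) → Set
ExistentiallyDefinable p M = Σ (ExF 1) λ Φ → DefinedBy p Φ M

-- With q = p ^ |w| = m + 1 and c = ⟦ w ⟧, the value ⟦ w ^ k ⟧ is c (q ^ k − 1) / m.
-- So x is such a value iff m x + c = c y for some y = q ^ k, and the powers of q are
-- exactly the powers y of p with y ≡ 1 (mod m), because p has order |w| modulo m.
-- Both conditions are existential in Büchi arithmetic: "y is a power of p" is V_p(y, y).
module Submission where

open import Defs
open import Data.Nat using (ℕ; zero; suc; _+_; _*_; _^_; _≤_; _<_; s≤s; z<s; NonZero; >-nonZero; ≢-nonZero⁻¹; _%_; _/_)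
open import Data.Nat.Properties
open import Data.Nat.DivMod using (m≡m%n+[m/n]*n; m%n<n; [m+kn]%n≡m%n; m<n⇒m%n≡m; n%n≡0)
open import Data.Nat.Divisibility using (_∣_; divides; ∣-refl; ∣⇒≤)
open import Data.Nat.Tactic.RingSolver using (solve-∀)
open import Data.Fin using (Fin; toℕ) renaming (zero to fzero; suc to fsuc)
open import Data.List using (List; []; _∷_; _++_; length; foldl)
open import Data.List.Properties using (foldl-++; ++-assoc; ++-identityʳ)
open import Data.Product using (∃; ∃₂; _×_; _,_)
open import Data.Sum using (inj₁; inj₂)
open import Function.Bundles using (_⇔_; mk⇔; Equivalence)
open import Relation.Nullary using (contradiction)
open import Relation.Binary.PropositionalEquality using (_≡_; refl; sym; trans; cong; cong₂; module ≡-Reasoning)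

infix 25 _·_

_·_ : ∀ {n} → ℕ → Term n → Term n
zero  · t = `0
suc k · t = t `+ (k · t)

evalT-· : ∀ {n} (ρ : Env n) k t → evalT ρ (k · t) ≡ k * evalT ρ t
evalT-· ρ zero    t = refl
evalT-· ρ (suc k) t = cong (evalT ρ t +_) (evalT-· ρ k t)

Range : (ℕ → ℕ) → ℕ → Set
Range f x = ∃ λ k → x ≡ f k

ExistentiallyDefinable-Range-cong : ∀ {p} {f g : ℕ → ℕ} → (∀ k → f k ≡ g k)
  → ExistentiallyDefinable p (Range f) → ExistentiallyDefinable p (Range g)
ExistentiallyDefinable-Range-cong f≗g (Φ , def) = Φ , λ x →
  let sound , complete = def x in
  (λ φ → let k , x≡ = sound φ in k , trans x≡ (f≗g k)) ,
  (λ (k , x≡) → complete (k , trans x≡ (sym (f≗g k))))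

repunit : ℕ → ℕ → ℕ
repunit q zero    = 0
repunit q (suc k) = q * repunit q k + 1

pow-repunit : ∀ m k → suc m ^ k ≡ m * repunit (suc m) k + 1
pow-repunit m zero    = cong (_+ 1) (sym (*-zeroʳ m))
pow-repunit m (suc k) = trans (cong (suc m *_) (pow-repunit m k)) (lemma m (repunit (suc m) k))
  where
  lemma : ∀ m r → (1 + m) * (m * r + 1) ≡ m * ((1 + m) * r + 1) + 1
  lemma = solve-∀

^ʷ-suc : ∀ {A : Set} (w : List A) k → w ^ʷ suc k ≡ (w ^ʷ k) ++ w
^ʷ-suc w zero    = ++-identityʳ w
^ʷ-suc w (suc k) = trans (cong (w ++_) (^ʷ-suc w k)) (sym (++-assoc w (w ^ʷ k) w))

module _ {p : ℕ} where

  private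
    step : ℕ → Fin p → ℕ
    step acc d = acc * p + toℕ d

  horner-from : ∀ a (v : List (Fin p)) → foldl step a v ≡ a * p ^ length v + ⟦ v ⟧[ p ]
  horner-from a []      = sym (trans (+-identityʳ (a * 1)) (*-identityʳ a))
  horner-from a (d ∷ v) = begin
    foldl step (a * p + toℕ d) v                                 ≡⟨ horner-from (a * p + toℕ d) v ⟩
    (a * p + toℕ d) * p ^ length v + ⟦ v ⟧[ p ]                   ≡⟨ lemma a p (toℕ d) (p ^ length v) ⟦ v ⟧[ p ] ⟩
    a * (p * p ^ length v) + (toℕ d * p ^ length v + ⟦ v ⟧[ p ])  ≡⟨ cong (a * (p * p ^ length v) +_) (sym (horner-from (toℕ d) v)) ⟩
    a * (p * p ^ length v) + foldl step (toℕ d) v                ∎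
    where
    open ≡-Reasoning
    lemma : ∀ a p d e f → (a * p + d) * e + f ≡ a * (p * e) + (d * e + f)
    lemma = solve-∀

  ⟦++⟧ : ∀ (u v : List (Fin p)) → ⟦ u ++ v ⟧[ p ] ≡ ⟦ u ⟧[ p ] * p ^ length v + ⟦ v ⟧[ p ]
  ⟦++⟧ u v = trans (foldl-++ step 0 u v) (horner-from ⟦ u ⟧[ p ] v)

  ⟦^ʷ⟧ : ∀ (w : List (Fin p)) k → ⟦ w ^ʷ k ⟧[ p ] ≡ ⟦ w ⟧[ p ] * repunit (p ^ length w) k
  ⟦^ʷ⟧ w zero    = sym (*-zeroʳ ⟦ w ⟧[ p ])
  ⟦^ʷ⟧ w (suc k) = begin
    ⟦ w ^ʷ suc k ⟧[ p ]                  ≡⟨ cong ⟦_⟧[ p ] (^ʷ-suc w k) ⟩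
    ⟦ (w ^ʷ k) ++ w ⟧[ p ]               ≡⟨ ⟦++⟧ (w ^ʷ k) w ⟩
    ⟦ w ^ʷ k ⟧[ p ] * q + c              ≡⟨ cong (λ t → t * q + c) (⟦^ʷ⟧ w k) ⟩
    c * repunit q k * q + c              ≡⟨ lemma c (repunit q k) q ⟩
    c * (q * repunit q k + 1)            ∎
    where
    open ≡-Reasoning
    q = p ^ length w
    c = ⟦ w ⟧[ p ]
    lemma : ∀ c r q → c * r * q + c ≡ c * (q * r + 1)
    lemma = solve-∀

RepunitMultipleCondition : ℕ → ℕ → ℕ → ℕ → Set
RepunitMultipleCondition p m c x = ∃₂ λ y z → V p y y × y ≡ m * z + 1 × m * x + c ≡ c * y

Φ-repunitMultiples : ℕ → ℕ → ExF 1
Φ-repunitMultiples m c = `∃ (`∃ (qf (`V y y `∧ ((y `≡ (m · z `+ `1)) `∧ ((m · x `+ c · `1) `≡ c · y)))))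
  where
  z y x : Term 3
  z = var fzero
  y = var (fsuc fzero)
  x = var (fsuc (fsuc fzero))

semEx-Φ-repunitMultiples : ∀ p m c x
  → semEx p (λ _ → x) (Φ-repunitMultiples m c) ⇔ RepunitMultipleCondition p m c x
semEx-Φ-repunitMultiples p m c x = mk⇔
  (λ (y , z , Vyy , y≡ , eq) → y , z , Vyy , trans y≡ (cong (_+ 1) (·z y z)) , trans (sym (lhs y z)) (trans eq (·y y z)))
  (λ (y , z , Vyy , y≡ , eq) → y , z , Vyy , trans y≡ (cong (_+ 1) (sym (·z y z))) , trans (lhs y z) (trans eq (sym (·y y z))))
  where
  ρ : ℕ → ℕ → Env 3
  ρ y z = extend z (extend y (λ _ → x))
  ·z : ∀ y z → evalT (ρ y z) (m · var fzero) ≡ m * z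
  ·z y z = evalT-· (ρ y z) m (var fzero)
  ·y : ∀ y z → evalT (ρ y z) (c · var (fsuc fzero)) ≡ c * y
  ·y y z = evalT-· (ρ y z) c (var (fsuc fzero))
  lhs : ∀ y z → evalT (ρ y z) (m · var (fsuc (fsuc fzero)) `+ c · `1) ≡ m * x + c
  lhs y z = cong₂ _+_ (evalT-· (ρ y z) m _) (trans (evalT-· (ρ y z) c `1) (*-identityʳ c))

a%m≡1%m⇒a≡1 : ∀ {a m} .{{_ : NonZero m}} → 0 < a → a ≤ m → a % m ≡ 1 % m → a ≡ 1
a%m≡1%m⇒a≡1 {a} {m} 0<a a≤m a≡1 with m≤n⇒m<n∨m≡n a≤m
... | inj₁ a<m = begin
  a      ≡⟨ sym (m<n⇒m%n≡m a<m) ⟩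
  a % m  ≡⟨ a≡1 ⟩
  1 % m  ≡⟨ m<n⇒m%n≡m (≤-<-trans 0<a a<m) ⟩
  1      ∎
  where open ≡-Reasoning
a%m≡1%m⇒a≡1 {suc zero}    0<a a≤m a≡1 | inj₂ refl = refl
a%m≡1%m⇒a≡1 {suc (suc a)} 0<a a≤m a≡1 | inj₂ refl =
  contradiction (trans (sym (n%n≡0 (2 + a))) a≡1) λ ()

module _ {p : ℕ} (1<p : 1 < p) where

  private instance
    p≢0 : NonZero p
    p≢0 = >-nonZero (<-trans z<s 1<p)

  V-pow : ∀ e → V p (p ^ e) (p ^ e)
  V-pow e =
    (e , refl) , ∣-refl ,
    (λ pq∣q → <⇒≱ (^-monoʳ-< p 1<p (n<1+n e)) (∣⇒≤ {{m^n≢0 p e}} pq∣q)) ,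
    ≢-nonZero⁻¹ (p ^ e) {{m^n≢0 p e}}

  module _ {n m : ℕ} .{{_ : NonZero n}} .{{m≢0 : NonZero m}} (pⁿ≡1+m : p ^ n ≡ suc m) where

    pow-multiple : ∀ a → p ^ (a * n) ≡ m * repunit (suc m) a + 1
    pow-multiple a = begin
      p ^ (a * n)  ≡⟨ cong (p ^_) (*-comm a n) ⟩
      p ^ (n * a)  ≡⟨ sym (^-*-assoc p n a) ⟩
      (p ^ n) ^ a  ≡⟨ cong (_^ a) pⁿ≡1+m ⟩
      suc m ^ a    ≡⟨ pow-repunit m a ⟩
      m * repunit (suc m) a + 1 ∎
      where open ≡-Reasoning

    -- p ^ n ≡ 1 (mod m), while the smaller powers 1 < p ^ r ≤ m are not ≡ 1 (mod m).
    p^j≡1-mod-m⇒n∣j : ∀ j → p ^ j % m ≡ 1 % m → n ∣ j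
    p^j≡1-mod-m⇒n∣j j pʲ≡1 = divides a j≡a*n
      where
      open ≡-Reasoning
      r = j % n
      a = j / n
      pʳ≡pʲ : p ^ r % m ≡ p ^ j % m
      pʳ≡pʲ = begin
        p ^ r % m                                        ≡⟨ sym ([m+kn]%n≡m%n (p ^ r) (p ^ r * repunit (suc m) a) m) ⟩
        (p ^ r + p ^ r * repunit (suc m) a * m) % m      ≡⟨ cong (_% m) (lemma (p ^ r) m (repunit (suc m) a)) ⟩
        p ^ r * (m * repunit (suc m) a + 1) % m          ≡⟨ cong (λ t → p ^ r * t % m) (sym (pow-multiple a)) ⟩
        p ^ r * p ^ (a * n) % m                          ≡⟨ cong (_% m) (sym (^-distribˡ-+-* p r (a * n))) ⟩
        p ^ (r + a * n) % m                              ≡⟨ cong (λ t → p ^ t % m) (sym (m≡m%n+[m/n]*n j n)) ⟩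
        p ^ j % m                                        ∎
        where
        lemma : ∀ e m r → e + e * r * m ≡ e * (m * r + 1)
        lemma = solve-∀
      pʳ≤m : p ^ r ≤ m
      pʳ≤m = ≤-pred (<-≤-trans (^-monoʳ-< p 1<p (m%n<n j n)) (≤-reflexive pⁿ≡1+m))
      r≡0 : r ≡ 0
      r≡0 with m^n≡1⇒n≡0∨m≡1 p r (a%m≡1%m⇒a≡1 (m^n>0 p r) pʳ≤m (trans pʳ≡pʲ pʲ≡1))
      ... | inj₁ r≡0 = r≡0
      ... | inj₂ refl = contradiction 1<p (<-irrefl refl)
      j≡a*n : j ≡ a * n
      j≡a*n = trans (m≡m%n+[m/n]*n j n) (cong (_+ a * n) r≡0)

    repunitMultiple⇔condition : ∀ c x
      → Range (λ k → c * repunit (suc m) k) x ⇔ RepunitMultipleCondition p m c x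
    repunitMultiple⇔condition c x = mk⇔ complete sound
      where
      open ≡-Reasoning
      complete : Range (λ k → c * repunit (suc m) k) x → RepunitMultipleCondition p m c x
      complete (k , refl) = p ^ (k * n) , repunit (suc m) k , V-pow (k * n) , pow-multiple k , (begin
        m * (c * repunit (suc m) k) + c  ≡⟨ lemma m c (repunit (suc m) k) ⟩
        c * (m * repunit (suc m) k + 1)  ≡⟨ cong (c *_) (sym (pow-multiple k)) ⟩
        c * p ^ (k * n)                  ∎)
        where
        lemma : ∀ m c r → m * (c * r) + c ≡ c * (m * r + 1)
        lemma = solve-∀
      sound : RepunitMultipleCondition p m c x → Range (λ k → c * repunit (suc m) k) x
      sound (y , z , ((j , refl) , _) , y≡1+mz , mx+c≡cy) with p^j≡1-mod-m⇒n∣j j pʲ≡1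
        where
        pʲ≡1 : p ^ j % m ≡ 1 % m
        pʲ≡1 = trans (cong (_% m) (trans y≡1+mz (trans (+-comm (m * z) 1) (cong (1 +_) (*-comm m z)))))
                     ([m+kn]%n≡m%n 1 z m)
      ... | divides a refl = a , *-cancelˡ-≡ x (c * repunit (suc m) a) m (+-cancelʳ-≡ c _ _ (begin
        m * x + c                        ≡⟨ mx+c≡cy ⟩
        c * p ^ (a * n)                  ≡⟨ cong (c *_) (pow-multiple a) ⟩
        c * (m * repunit (suc m) a + 1)  ≡⟨ lemma m c (repunit (suc m) a) ⟩
        m * (c * repunit (suc m) a) + c  ∎))
        where
        lemma : ∀ m c r → c * (m * r + 1) ≡ m * (c * r) + c
        lemma = solve-∀

    repunitMultiples-definable : ∀ c → ExistentiallyDefinable p (Range (λ k → c * repunit (suc m) k))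
    repunitMultiples-definable c = Φ-repunitMultiples m c , λ x →
      (λ φ → from (repunitMultiple⇔condition c x) (to (semEx-Φ-repunitMultiples p m c x) φ)) ,
      (λ r → from (semEx-Φ-repunitMultiples p m c x) (to (repunitMultiple⇔condition c x) r))
      where open Equivalence

zero-definable : ∀ p → ExistentiallyDefinable p (Range (λ _ → 0))
zero-definable p = qf (var fzero `≡ `0) , λ x → (λ x≡0 → 0 , x≡0) , (λ (_ , x≡0) → x≡0)

>1⇒pred-nonZero : ∀ {q} → 1 < q → ∃ λ m → q ≡ suc m × NonZero m
>1⇒pred-nonZero {suc zero}    (s≤s ())
>1⇒pred-nonZero {suc (suc m)} _ = suc m , refl , _

lemma7 : (p : ℕ) → 2 ≤ p → (w : List (Fin p))
    → ExistentiallyDefinable p (λ m → ∃ λ k → m ≡ ⟦ w ^ʷ k ⟧[ p ])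
lemma7 p 1<p [] = ExistentiallyDefinable-Range-cong (λ k → sym (⟦^ʷ⟧ {p} [] k)) (zero-definable p)
lemma7 p 1<p w@(_ ∷ _) with >1⇒pred-nonZero (^-monoʳ-< p 1<p {0} {length w} z<s)
... | m , pⁿ≡1+m , m≢0 =
  ExistentiallyDefinable-Range-cong ⟦w^k⟧≡ (repunitMultiples-definable 1<p {n = length w} {{m≢0 = m≢0}} pⁿ≡1+m ⟦ w ⟧[ p ])
  where
  ⟦w^k⟧≡ : ∀ k → ⟦ w ⟧[ p ] * repunit (suc m) k ≡ ⟦ w ^ʷ k ⟧[ p ]
  ⟦w^k⟧≡ k = sym (trans (⟦^ʷ⟧ w k) (cong (λ q → ⟦ w ⟧[ p ] * repunit q k) pⁿ≡1+m))
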